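{- Consider an execution of Random Order Greedy (see context) with an arbitrary fixed permutation $\pi$. For every subset $S\subseteq\mathcal{N}$, every base $T$ of the partition matroid, and every $1\le i\le m$, \[ f(A_i)+f(S\cup A_i\cup T^{(i)}) \ge f(A_{i-1})+f(S\cup A_{i-1}\cup T^{(i-1)}). \]
   Context: $\mathcal{N}$ is a finite ground set partitioned into non-empty disjoint sets $P_1,\dots,P_m$; $f\colon 2^{\mathcal{N}}\to\mathbb{R}_{\ge0}$ is non-negative, monotone ($f(S)\le f(T)$ for $S\subseteq T$) and submodular. A base of the partition matroid is a set containing exactly one element of each $P_j$. Write $f(u\mid A)=f(A\cup\{u\})-f(A)$. Random Order Greedy: $A_0=\varnothing$; $\pi$ is a permutation of $\{1,\dots,m\}$ (uniformly random in the algorithm); for $i=1,\dots,m$, $u_i$ is an element $u\in P_{\pi(i)}$ maximizing $f(u\mid A_{i-1})$, and $A_i=A_{i-1}\cup\{u_i\}$. For $T\subseteq\mathcal{N}$ and $0\le i\le m$, $T^{(i)} = T\setminus\bigcup_{j=1}^{i}P_{\pi(j)}$.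
   Formalization: The set function f takes non-negative rational values rather than non-negative real values. -}

module Defs where

open import Data.Nat using (ℕ; zero; suc)
open import Data.Fin using (Fin; zero; suc; toℕ)
open import Data.Fin.Subset using (Subset; ⊥; ⁅_⁆; _∪_; _∩_; ∁; _∈_; _⊆_)
open import Data.Fin.Permutation using (Permutation′; _⟨$⟩ʳ_)
open import Data.Vec using (tabulate; lookup)
open import Data.Product using (∃-syntax; _×_)
open import Data.Rational using (ℚ; 0ℚ; _≤_; _+_; _-_)
open import Relation.Binary.PropositionalEquality using (_≡_)
open import Function using (_∘_)

-- Ground set 𝒩 = Fin n.  Partition into m parts P_0,…,P_{m-1}:
-- `part x` is the index of the unique part containing x.
-- (Parts are 0-indexed: P_j of the paper is part index j-1.)

PartsNonEmpty : ∀ {n m} → (Fin n → Fin m) → Set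
PartsNonEmpty {n} {m} part = (j : Fin m) → ∃[ x ] (part x ≡ j)

SetFn : ℕ → Set
SetFn n = Subset n → ℚ

NonNegative : ∀ {n} → SetFn n → Set
NonNegative f = ∀ A → 0ℚ ≤ f A

Monotone : ∀ {n} → SetFn n → Set
Monotone f = ∀ A B → A ⊆ B → f A ≤ f B

Submodular : ∀ {n} → SetFn n → Set
Submodular f = ∀ A B → f (A ∪ B) + f (A ∩ B) ≤ f A + f B

marginal : ∀ {n} → SetFn n → Fin n → Subset n → ℚ
marginal f u A = f (A ∪ ⁅ u ⁆) - f A

IsBase : ∀ {n m} → (Fin n → Fin m) → Subset n → Set
IsBase {n} {m} part T =
  (j : Fin m) → ∃[ x ] (x ∈ T × part x ≡ j × ((y : Fin n) → y ∈ T → part y ≡ j → y ≡ x))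

prefixSet : ∀ {n m} → (Fin m → Fin n) → ℕ → Subset n
prefixSet {m = zero}  u k       = ⊥
prefixSet {m = suc m} u zero    = ⊥
prefixSet {m = suc m} u (suc k) = ⁅ u zero ⁆ ∪ prefixSet (u ∘ suc) k

-- A_k = { u_1, …, u_k } of the paper (our u is 0-indexed).
A[_,_] : ∀ {n m} → (Fin m → Fin n) → ℕ → Subset n
A[ u , k ] = prefixSet u k

-- T^{(k)} = T ∖ ⋃_{j ≤ k} P_{π(j)}
T⁽_⁾ : ∀ {n m} → (Fin n → Fin m) → Permutation′ m → Subset n → ℕ → Subset n
T⁽_⁾ part π T k =
  T ∩ ∁ (tabulate (λ x → lookup (prefixSet (π ⟨$⟩ʳ_) k) (part x)))

-- (u, π) is an execution of Random Order Greedy with (fixed) permutation π: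
-- at step i+1 (i : Fin m, 0-indexed) the chosen element u i lies in P_{π(i)}
-- and maximises f(· | A_i) over P_{π(i)} (ties broken arbitrarily).
IsGreedyExecution : ∀ {n m} → (Fin n → Fin m) → SetFn n → Permutation′ m →
                    (Fin m → Fin n) → Set
IsGreedyExecution {n} {m} part f π u =
  (i : Fin m) →
    part (u i) ≡ π ⟨$⟩ʳ i ×
    ((v : Fin n) → part v ≡ π ⟨$⟩ʳ i →
       marginal f v A[ u , toℕ i ] ≤ marginal f (u i) A[ u , toℕ i ])

{-# OPTIONS --safe #-}
-- Let t be the element of the base T in the part P handled at step i, X = Aᵢ ∪ {t} and
-- D = S ∪ Aᵢ₊₁ ∪ Tᵢ₊₁.  Since Tᵢ ⊆ Tᵢ₊₁ ∪ {t}, we have S ∪ Aᵢ ∪ Tᵢ ⊆ X ∪ D and Aᵢ ⊆ X ∩ D, so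
-- monotonicity and submodularity give f(Aᵢ) + f(S ∪ Aᵢ ∪ Tᵢ) ≤ f(X) + f(D).  Finally
-- f(X) ≤ f(Aᵢ₊₁) because the greedy choice uᵢ has the largest marginal value f(· | Aᵢ) in P.
module Submission where

open import Defs
open import Data.Nat using (ℕ; zero; suc)
open import Data.Fin using (Fin; toℕ; zero; suc; _≟_)
open import Data.Fin.Subset using (Subset; ⊥; ⁅_⁆; _∪_; _∩_; ∁; _∈_; _⊆_)
open import Data.Fin.Subset.Properties
open import Data.Fin.Permutation using (Permutation′; _⟨$⟩ʳ_)
open import Data.Rational using (0ℚ; _≤_; _+_; _-_; -_)
open import Data.Rational.Properties
  using (+-mono-≤; +-monoˡ-≤; +-assoc; +-comm; +-inverseˡ; +-identityʳ; module ≤-Reasoning)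
open import Data.Vec using (tabulate; lookup)
open import Data.Vec.Properties using (lookup∘tabulate; []=⇒lookup; lookup⇒[]=)
open import Data.Product using (_,_; proj₂)
open import Data.Sum using (inj₁; inj₂; [_,_])
open import Function using (_∘_)
open import Relation.Nullary using (¬_; yes; no)
open import Relation.Binary.PropositionalEquality hiding ([_])

p-r≤q-r⇒p≤q : ∀ {p q} r → p - r ≤ q - r → p ≤ q
p-r≤q-r⇒p≤q {p} {q} r p-r≤q-r = subst₂ _≤_ (-r+r p) (-r+r q) (+-monoˡ-≤ r p-r≤q-r)
  where
  -r+r : ∀ s → (s - r) + r ≡ s
  -r+r s = begin
    (s - r) + r   ≡⟨ +-assoc s (- r) r ⟩
    s + (- r + r) ≡⟨ cong (s +_) (+-inverseˡ r) ⟩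
    s + 0ℚ        ≡⟨ +-identityʳ s ⟩
    s             ∎
    where open ≡-Reasoning

submodular-exchange : ∀ {n} {f : SetFn n} → Monotone f → Submodular f → ∀ {A C X D} →
                      A ⊆ X ∩ D → C ⊆ X ∪ D → f A + f C ≤ f X + f D
submodular-exchange {f = f} mono sub {A} {C} {X} {D} A⊆X∩D C⊆X∪D = begin
  f A + f C             ≤⟨ +-mono-≤ (mono _ _ A⊆X∩D) (mono _ _ C⊆X∪D) ⟩
  f (X ∩ D) + f (X ∪ D) ≡⟨ +-comm (f (X ∩ D)) (f (X ∪ D)) ⟩
  f (X ∪ D) + f (X ∩ D) ≤⟨ sub X D ⟩
  f X + f D             ∎
  where open ≤-Reasoning

prefixSet-zero : ∀ {n m} (u : Fin m → Fin n) → prefixSet u 0 ≡ ⊥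
prefixSet-zero {m = zero}  u = refl
prefixSet-zero {m = suc m} u = refl

prefixSet-suc : ∀ {n m} (u : Fin m → Fin n) (i : Fin m) →
                prefixSet u (suc (toℕ i)) ≡ prefixSet u (toℕ i) ∪ ⁅ u i ⁆
prefixSet-suc u zero = begin
  ⁅ u zero ⁆ ∪ prefixSet (u ∘ suc) 0 ≡⟨ cong (⁅ u zero ⁆ ∪_) (prefixSet-zero (u ∘ suc)) ⟩
  ⁅ u zero ⁆ ∪ ⊥                      ≡⟨ ∪-identityʳ ⁅ u zero ⁆ ⟩
  ⁅ u zero ⁆                          ≡⟨ ∪-identityˡ ⁅ u zero ⁆ ⟨
  ⊥ ∪ ⁅ u zero ⁆                      ∎
  where open ≡-Reasoning
prefixSet-suc u (suc i) = begin
  ⁅ u zero ⁆ ∪ prefixSet (u ∘ suc) (suc (toℕ i))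
    ≡⟨ cong (⁅ u zero ⁆ ∪_) (prefixSet-suc (u ∘ suc) i) ⟩
  ⁅ u zero ⁆ ∪ (prefixSet (u ∘ suc) (toℕ i) ∪ ⁅ u (suc i) ⁆)
    ≡⟨ ∪-assoc ⁅ u zero ⁆ _ _ ⟨
  (⁅ u zero ⁆ ∪ prefixSet (u ∘ suc) (toℕ i)) ∪ ⁅ u (suc i) ⁆
    ∎
  where open ≡-Reasoning

preimage : ∀ {n m} → (Fin n → Fin m) → Subset m → Subset n
preimage g p = tabulate (λ x → lookup p (g x))

module _ {n m} (g : Fin n → Fin m) (p : Subset m) {x : Fin n} where

  ∈-preimage⁻ : x ∈ preimage g p → g x ∈ p
  ∈-preimage⁻ x∈g⁻¹p =
    lookup⇒[]= (g x) p (trans (sym (lookup∘tabulate _ x)) ([]=⇒lookup x∈g⁻¹p))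

  ∈-preimage⁺ : g x ∈ p → x ∈ preimage g p
  ∈-preimage⁺ gx∈p =
    lookup⇒[]= x (preimage g p) (trans (lookup∘tabulate _ x) ([]=⇒lookup gx∈p))

-- T⁽ part ⁾ π T k unfolds to residual part T (prefixSet (π ⟨$⟩ʳ_) k).
residual : ∀ {n m} → (Fin n → Fin m) → Subset n → Subset m → Subset n
residual g T p = T ∩ ∁ (preimage g p)

residual-∪⁅⁆ : ∀ {n m} (g : Fin n → Fin m) (T : Subset n) (p : Subset m) (j : Fin m) {t : Fin n} →
               (∀ y → y ∈ T → g y ≡ j → y ≡ t) →
               residual g T p ⊆ residual g T (p ∪ ⁅ j ⁆) ∪ ⁅ t ⁆
residual-∪⁅⁆ g T p j t-unique {x} x∈R with x∈p∩q⁻ T _ x∈R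
... | x∈T , x∈∁g⁻¹p with g x ≟ j
...   | yes gx≡j = q⊆p∪q _ _ (subst (_∈ ⁅ _ ⁆) (sym (t-unique x x∈T gx≡j)) (x∈⁅x⁆ _))
...   | no  gx≢j = p⊆p∪q _ (x∈p∩q⁺ (x∈T , x∉p⇒x∈∁p (gx∉p∪⁅j⁆ ∘ ∈-preimage⁻ g _)))
  where
  gx∉p∪⁅j⁆ : ¬ g x ∈ p ∪ ⁅ j ⁆
  gx∉p∪⁅j⁆ = [ x∈∁p⇒x∉p x∈∁g⁻¹p ∘ ∈-preimage⁺ g p , gx≢j ∘ x∈⁅y⁆⇒x≡y j ] ∘ x∈p∪q⁻ p _

T⁽⁾-suc-⊆ : ∀ {n m} (part : Fin n → Fin m) (π : Permutation′ m) (T : Subset n) (i : Fin m) {t} →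
            (∀ y → y ∈ T → part y ≡ π ⟨$⟩ʳ i → y ≡ t) →
            T⁽ part ⁾ π T (toℕ i) ⊆ T⁽ part ⁾ π T (suc (toℕ i)) ∪ ⁅ t ⁆
T⁽⁾-suc-⊆ part π T i {t} t-unique =
  subst (λ p → residual part T (prefixSet (π ⟨$⟩ʳ_) (toℕ i)) ⊆ residual part T p ∪ ⁅ t ⁆)
        (sym (prefixSet-suc (π ⟨$⟩ʳ_) i))
        (residual-∪⁅⁆ part T (prefixSet (π ⟨$⟩ʳ_) (toℕ i)) (π ⟨$⟩ʳ i) t-unique)

A-⊆-suc : ∀ {n m} (u : Fin m → Fin n) (i : Fin m) → A[ u , toℕ i ] ⊆ A[ u , suc (toℕ i) ]
A-⊆-suc u i = subst (A[ u , toℕ i ] ⊆_) (sym (prefixSet-suc u i)) (p⊆p∪q _)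

module _ {n} {S A A′ R′ Y : Subset n} (A⊆A′ : A ⊆ A′) where

  ⊆-∩-exchange : A ⊆ (A ∪ Y) ∩ (S ∪ A′ ∪ R′)
  ⊆-∩-exchange x∈A = x∈p∩q⁺ (p⊆p∪q Y x∈A , q⊆p∪q S _ (p⊆p∪q R′ (A⊆A′ x∈A)))

  ⊆-∪-exchange : ∀ {R} → R ⊆ R′ ∪ Y → S ∪ A ∪ R ⊆ (A ∪ Y) ∪ (S ∪ A′ ∪ R′)
  ⊆-∪-exchange R⊆R′∪Y x∈S∪A∪R with x∈p∪q⁻ S _ x∈S∪A∪R
  ... | inj₁ x∈S = q⊆p∪q _ _ (p⊆p∪q _ x∈S)
  ... | inj₂ x∈A∪R with x∈p∪q⁻ A _ x∈A∪R
  ...   | inj₁ x∈A = p⊆p∪q _ (p⊆p∪q Y x∈A)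
  ...   | inj₂ x∈R with x∈p∪q⁻ R′ Y (R⊆R′∪Y x∈R)
  ...     | inj₁ x∈R′ = q⊆p∪q _ _ (q⊆p∪q S _ (q⊆p∪q A′ R′ x∈R′))
  ...     | inj₂ x∈Y = p⊆p∪q _ (q⊆p∪q A Y x∈Y)

greedy-choice-dominates : ∀ {n m} {part : Fin n → Fin m} {f : SetFn n} {π u} →
                          IsGreedyExecution part f π u → (i : Fin m) (v : Fin n) →
                          part v ≡ π ⟨$⟩ʳ i → f (A[ u , toℕ i ] ∪ ⁅ v ⁆) ≤ f A[ u , suc (toℕ i) ]
greedy-choice-dominates {f = f} {u = u} greedy i v part-v =
  subst (f (A[ u , toℕ i ] ∪ ⁅ v ⁆) ≤_) (cong f (sym (prefixSet-suc u i)))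
        (p-r≤q-r⇒p≤q (f A[ u , toℕ i ]) (proj₂ (greedy i) v part-v))

lemma3p2 : ∀ {n m : ℕ} (part : Fin n → Fin m) (f : SetFn n) →
    PartsNonEmpty part → NonNegative f → Monotone f → Submodular f →
    (π : Permutation′ m) (u : Fin m → Fin n) → IsGreedyExecution part f π u →
    (S T : Subset n) → IsBase part T → (i : Fin m) →
    f A[ u , toℕ i ] + f (S ∪ A[ u , toℕ i ] ∪ T⁽ part ⁾ π T (toℕ i))
      ≤ f A[ u , suc (toℕ i) ] + f (S ∪ A[ u , suc (toℕ i) ] ∪ T⁽ part ⁾ π T (suc (toℕ i)))
lemma3p2 {n} part f _ _ mono sub π u greedy S T base i with base (π ⟨$⟩ʳ i)
... | t , _ , part-t , t-unique = begin
  f Aᵢ + f (S ∪ Aᵢ ∪ Tᵢ)       ≤⟨ submodular-exchange mono sub Aᵢ⊆X∩D C⊆X∪D ⟩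
  f (Aᵢ ∪ ⁅ t ⁆) + f D         ≤⟨ +-monoˡ-≤ (f D) (greedy-choice-dominates {f = f} {π = π} greedy i t part-t) ⟩
  f A[ u , suc (toℕ i) ] + f D ∎
  where
  open ≤-Reasoning
  Aᵢ Tᵢ D : Subset n
  Aᵢ = A[ u , toℕ i ]
  Tᵢ = T⁽ part ⁾ π T (toℕ i)
  D = S ∪ A[ u , suc (toℕ i) ] ∪ T⁽ part ⁾ π T (suc (toℕ i))

  Aᵢ⊆X∩D : Aᵢ ⊆ (Aᵢ ∪ ⁅ t ⁆) ∩ D
  Aᵢ⊆X∩D = ⊆-∩-exchange (A-⊆-suc u i)

  C⊆X∪D : S ∪ Aᵢ ∪ Tᵢ ⊆ (Aᵢ ∪ ⁅ t ⁆) ∪ D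
  C⊆X∪D = ⊆-∪-exchange (A-⊆-suc u i) (T⁽⁾-suc-⊆ part π T i t-unique)
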